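{- Let $L$ be a Boolean algebra and let $\hat L_{\bowtie}$ be the change action on $L$ whose change set is $L\bowtie L=\{(p,q)\in L\times L \mid p\wedge q=\bot\}$, with monoid operation $(p,q)\bowtie(r,s)=((p\wedge\neg s)\vee r,\ (q\wedge\neg r)\vee s)$, identity $(\bot,\bot)$, and action $a\oplus_{\bowtie}(p,q)=(a\vee p)\wedge\neg q$. Then the map $\bowtie$ indeed sends $(L\bowtie L)\times(L\bowtie L)$ into $L\bowtie L$, $\oplus_{\bowtie}$ is a monoid action (so $\hat L_{\bowtie}$ is a change action), and $\hat L_{\bowtie}$ is complete, i.e. transitive: for all $a,b\in L$ there is $(p,q)\in L\bowtie L$ with $a\oplus_{\bowtie}(p,q)=b$.
   Context: A change action $\hat A=(A,\Delta A,\oplus,+,0)$ consists of a set $A$, a monoid $(\Delta A,+,0)$ and a map $\oplus:A\times\Delta A\to A$ satisfying $a\oplus 0=a$ and $a\oplus(\delta_1+\delta_2)=(a\oplus\delta_1)\oplus\delta_2$. It is transitive if for all $a,b\in A$ there is $\delta\in\Delta A$ with $a\oplus\delta=b$. -}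

module Defs where

open import Level using (Level; _⊔_)
open import Data.Product using (Σ; _×_; _,_; proj₁; proj₂; ∃-syntax)
open import Algebra.Lattice.Bundles using (BooleanAlgebra)

module BowtieChange {c ℓ : Level} (L : BooleanAlgebra c ℓ) where
  open BooleanAlgebra L

  Pair : Set c
  Pair = Carrier × Carrier

  _⋈_ : Pair → Pair → Pair
  (p , q) ⋈ (r , s) = ((p ∧ ¬ s) ∨ r) , ((q ∧ ¬ r) ∨ s)

  InBowtie : Pair → Set ℓ
  InBowtie (p , q) = p ∧ q ≈ ⊥

  𝟘 : Pair
  𝟘 = ⊥ , ⊥

  _≈ₚ_ : Pair → Pair → Set ℓ
  (p , q) ≈ₚ (r , s) = (p ≈ r) × (q ≈ s)

  _⊕_ : Carrier → Pair → Carrier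
  a ⊕ (p , q) = (a ∨ p) ∧ ¬ q

  record BowtieIsCompleteChangeAction : Set (c ⊔ ℓ) where
    field
      closed   : ∀ x y → InBowtie x → InBowtie y → InBowtie (x ⋈ y)
      zero-in  : InBowtie 𝟘
      identityˡ : ∀ x → InBowtie x → (𝟘 ⋈ x) ≈ₚ x
      identityʳ : ∀ x → InBowtie x → (x ⋈ 𝟘) ≈ₚ x
      assoc    : ∀ x y z → InBowtie x → InBowtie y → InBowtie z →
                 ((x ⋈ y) ⋈ z) ≈ₚ (x ⋈ (y ⋈ z))
      act-zero : ∀ a → (a ⊕ 𝟘) ≈ a
      act-comp : ∀ a x y → InBowtie x → InBowtie y →
                 (a ⊕ (x ⋈ y)) ≈ ((a ⊕ x) ⊕ y)
      transitive : ∀ a b → ∃[ x ] (InBowtie x × (a ⊕ x) ≈ b)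

-- In any Boolean algebra the equations needed here (the monoid laws for ⋈, the action laws for ⊕,
-- and the two identities behind closure and transitivity) hold as soon as they hold in the
-- two-element Boolean algebra, which is a finite truth-table check decided by computation.
-- That an equation valid on truth values is valid everywhere follows by Shannon expansion on
-- the first variable, x ≈ (v ∧ x[⊤/v]) ∨ (¬ v ∧ x[⊥/v]), and induction on the number of variables.
-- Closure of L ⋈ L under ⋈ is then the identity
--   ((p ∧ ¬ s) ∨ r) ∧ ((q ∧ ¬ r) ∨ s) ≈ ((p ∧ q) ∧ ¬ (r ∨ s)) ∨ (r ∧ s),
-- and transitivity is witnessed by (b ∧ ¬ a , a ∧ ¬ b).
module Submission where

open import Defs
open import Level using (Level)
open import Algebra.Lattice.Bundles using (BooleanAlgebra)
open import Algebra.Bundles using (IdempotentCommutativeMonoid)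
open import Data.Bool as Bool using (Bool; true; false; T)
open import Data.Bool.Properties using (T-∧)
open import Data.Fin using (Fin; zero; suc)
open import Data.Nat using (ℕ; zero; suc)
open import Data.Product using (Σ; _×_; _,_; proj₁; proj₂)
open import Data.Vec using (Vec; []; _∷_; lookup; map; allFin)
open import Data.Vec.N-ary using (N-ary; _$ⁿ_)
open import Function.Bundles using (Equivalence)
open import Relation.Nullary.Decidable using (isYes; toWitness)
open import Relation.Binary.PropositionalEquality as ≡ using (_≡_)

infixr 7 _and_
infixr 6 _or_
infix 4 _⊜_

data Expr (n : ℕ) : Set where
  var        : Fin n → Expr n
  top bot    : Expr n
  _and_ _or_ : Expr n → Expr n → Expr n
  not        : Expr n → Expr n

_⊜_ : ∀ {n} → Expr n → Expr n → Expr n × Expr n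
_⊜_ = _,_

close : ∀ n → N-ary n (Expr n) (Expr n × Expr n) → Expr n × Expr n
close n f = f $ⁿ map var (allFin n)

const : ∀ {n} → Bool → Expr n
const true  = top
const false = bot

_[_] : ∀ {n} → Expr (suc n) → Bool → Expr n
var zero    [ b ] = const b
var (suc i) [ b ] = var i
top         [ b ] = top
bot         [ b ] = bot
(e and f)   [ b ] = e [ b ] and f [ b ]
(e or f)    [ b ] = e [ b ] or f [ b ]
not e       [ b ] = not (e [ b ])

evalᴮ : Expr 0 → Bool
evalᴮ top       = true
evalᴮ bot       = false
evalᴮ (e and f) = evalᴮ e Bool.∧ evalᴮ f
evalᴮ (e or f)  = evalᴮ e Bool.∨ evalᴮ f
evalᴮ (not e)   = Bool.not (evalᴮ e)

equivalent : ∀ n → Expr n → Expr n → Bool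
equivalent zero    e f = isYes (evalᴮ e Bool.≟ evalᴮ f)
equivalent (suc n) e f =
  equivalent n (e [ true ]) (f [ true ]) Bool.∧ equivalent n (e [ false ]) (f [ false ])

module Tautology {c ℓ : Level} (L : BooleanAlgebra c ℓ) where
  open BooleanAlgebra L
  open import Algebra.Lattice.Properties.BooleanAlgebra L
  open import Relation.Binary.Reasoning.Setoid setoid

  ⟦_⟧ : ∀ {n} → Expr n → Vec Carrier n → Carrier
  ⟦ var i   ⟧ ρ = lookup ρ i
  ⟦ top     ⟧ ρ = ⊤
  ⟦ bot     ⟧ ρ = ⊥
  ⟦ e and f ⟧ ρ = ⟦ e ⟧ ρ ∧ ⟦ f ⟧ ρ
  ⟦ e or f  ⟧ ρ = ⟦ e ⟧ ρ ∨ ⟦ f ⟧ ρ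
  ⟦ not e   ⟧ ρ = ¬ ⟦ e ⟧ ρ

  ⌜_⌝ : Bool → Carrier
  ⌜ true  ⌝ = ⊤
  ⌜ false ⌝ = ⊥

  ⌜⌝-∧ : ∀ a b → ⌜ a ⌝ ∧ ⌜ b ⌝ ≈ ⌜ a Bool.∧ b ⌝
  ⌜⌝-∧ true  b = ∧-identityˡ ⌜ b ⌝
  ⌜⌝-∧ false b = ∧-zeroˡ ⌜ b ⌝

  ⌜⌝-∨ : ∀ a b → ⌜ a ⌝ ∨ ⌜ b ⌝ ≈ ⌜ a Bool.∨ b ⌝
  ⌜⌝-∨ true  b = ∨-zeroˡ ⌜ b ⌝
  ⌜⌝-∨ false b = ∨-identityˡ ⌜ b ⌝

  ⌜⌝-¬ : ∀ a → ¬ ⌜ a ⌝ ≈ ⌜ Bool.not a ⌝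
  ⌜⌝-¬ true  = ¬⊤≈⊥
  ⌜⌝-¬ false = ¬⊥≈⊤

  ⟦const⟧ : ∀ {n} b (ρ : Vec Carrier n) → ⟦ const b ⟧ ρ ≡ ⌜ b ⌝
  ⟦const⟧ true  ρ = ≡.refl
  ⟦const⟧ false ρ = ≡.refl

  ⟦[]⟧ : ∀ {n} (e : Expr (suc n)) b ρ → ⟦ e [ b ] ⟧ ρ ≡ ⟦ e ⟧ (⌜ b ⌝ ∷ ρ)
  ⟦[]⟧ (var zero)    b ρ = ⟦const⟧ b ρ
  ⟦[]⟧ (var (suc i)) b ρ = ≡.refl
  ⟦[]⟧ top           b ρ = ≡.refl
  ⟦[]⟧ bot           b ρ = ≡.refl
  ⟦[]⟧ (e and f)     b ρ = ≡.cong₂ _∧_ (⟦[]⟧ e b ρ) (⟦[]⟧ f b ρ)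
  ⟦[]⟧ (e or f)      b ρ = ≡.cong₂ _∨_ (⟦[]⟧ e b ρ) (⟦[]⟧ f b ρ)
  ⟦[]⟧ (not e)       b ρ = ≡.cong ¬_ (⟦[]⟧ e b ρ)

  ⟦⟧-closed : ∀ e → ⟦ e ⟧ [] ≈ ⌜ evalᴮ e ⌝
  ⟦⟧-closed top       = refl
  ⟦⟧-closed bot       = refl
  ⟦⟧-closed (e and f) = trans (∧-cong (⟦⟧-closed e) (⟦⟧-closed f)) (⌜⌝-∧ (evalᴮ e) (evalᴮ f))
  ⟦⟧-closed (e or f)  = trans (∨-cong (⟦⟧-closed e) (⟦⟧-closed f)) (⌜⌝-∨ (evalᴮ e) (evalᴮ f))
  ⟦⟧-closed (not e)   = trans (¬-cong (⟦⟧-closed e)) (⌜⌝-¬ (evalᴮ e))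

  ∧-idempotentCommutativeMonoid : IdempotentCommutativeMonoid c ℓ
  ∧-idempotentCommutativeMonoid = record
    { isIdempotentCommutativeMonoid = record
      { isCommutativeMonoid = ∧-⊤-isCommutativeMonoid
      ; idem                = ∧-idem
      }
    }

  open import Algebra.Properties.IdempotentCommutativeMonoid ∧-idempotentCommutativeMonoid
    using () renaming (∙-distrˡ-∙ to ∧-distribˡ-∧)

  x∧¬[x∧y]≈x∧¬y : ∀ x y → x ∧ ¬ (x ∧ y) ≈ x ∧ ¬ y
  x∧¬[x∧y]≈x∧¬y x y = begin
    x ∧ ¬ (x ∧ y)          ≈⟨ ∧-congˡ (deMorgan₁ x y) ⟩
    x ∧ (¬ x ∨ ¬ y)        ≈⟨ ∧-distribˡ-∨ x (¬ x) (¬ y) ⟩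
    (x ∧ ¬ x) ∨ (x ∧ ¬ y)  ≈⟨ ∨-congʳ (∧-complementʳ x) ⟩
    ⊥ ∨ (x ∧ ¬ y)          ≈⟨ ∨-identityˡ (x ∧ ¬ y) ⟩
    x ∧ ¬ y                ∎

  -- Meeting with y is a Boolean algebra morphism onto the interval [⊥ , y], so it respects
  -- every expression.
  ∧-⟦⟧-cong : ∀ {n y x x′} → y ∧ x ≈ y ∧ x′ → (e : Expr (suc n)) (ρ : Vec Carrier n) →
              y ∧ ⟦ e ⟧ (x ∷ ρ) ≈ y ∧ ⟦ e ⟧ (x′ ∷ ρ)
  ∧-⟦⟧-cong y∧x≈y∧x′ (var zero)    ρ = y∧x≈y∧x′
  ∧-⟦⟧-cong y∧x≈y∧x′ (var (suc i)) ρ = refl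
  ∧-⟦⟧-cong y∧x≈y∧x′ top           ρ = refl
  ∧-⟦⟧-cong y∧x≈y∧x′ bot           ρ = refl
  ∧-⟦⟧-cong {y = y} y∧x≈y∧x′ (e and f) ρ =
    trans (∧-distribˡ-∧ y _ _)
      (trans (∧-cong (∧-⟦⟧-cong y∧x≈y∧x′ e ρ) (∧-⟦⟧-cong y∧x≈y∧x′ f ρ))
        (sym (∧-distribˡ-∧ y _ _)))
  ∧-⟦⟧-cong {y = y} y∧x≈y∧x′ (e or f) ρ =
    trans (∧-distribˡ-∨ y _ _)
      (trans (∨-cong (∧-⟦⟧-cong y∧x≈y∧x′ e ρ) (∧-⟦⟧-cong y∧x≈y∧x′ f ρ))
        (sym (∧-distribˡ-∨ y _ _)))
  ∧-⟦⟧-cong {y = y} y∧x≈y∧x′ (not e) ρ =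
    trans (sym (x∧¬[x∧y]≈x∧¬y y _))
      (trans (∧-congˡ (¬-cong (∧-⟦⟧-cong y∧x≈y∧x′ e ρ)))
        (x∧¬[x∧y]≈x∧¬y y _))

  shannon : ∀ {n} (e : Expr (suc n)) x ρ →
            ⟦ e ⟧ (x ∷ ρ) ≈ (x ∧ ⟦ e [ true ] ⟧ ρ) ∨ (¬ x ∧ ⟦ e [ false ] ⟧ ρ)
  shannon e x ρ = begin
    E                                       ≈⟨ ∧-identityˡ E ⟨
    ⊤ ∧ E                                   ≈⟨ ∧-congʳ (∨-complementʳ x) ⟨
    (x ∨ ¬ x) ∧ E                           ≈⟨ ∧-distribʳ-∨ E x (¬ x) ⟩
    (x ∧ E) ∨ (¬ x ∧ E)                     ≈⟨ ∨-cong (∧-⟦⟧-cong x∧x≈x∧⊤ e ρ) (∧-⟦⟧-cong ¬x∧x≈¬x∧⊥ e ρ) ⟩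
    (x ∧ ⟦ e ⟧ (⊤ ∷ ρ)) ∨ (¬ x ∧ ⟦ e ⟧ (⊥ ∷ ρ))
      ≡⟨ ≡.cong₂ (λ t f → (x ∧ t) ∨ (¬ x ∧ f)) (⟦[]⟧ e true ρ) (⟦[]⟧ e false ρ) ⟨
    (x ∧ ⟦ e [ true ] ⟧ ρ) ∨ (¬ x ∧ ⟦ e [ false ] ⟧ ρ) ∎
    where
    E = ⟦ e ⟧ (x ∷ ρ)
    x∧x≈x∧⊤ : x ∧ x ≈ x ∧ ⊤
    x∧x≈x∧⊤ = trans (∧-idem x) (sym (∧-identityʳ x))
    ¬x∧x≈¬x∧⊥ : ¬ x ∧ x ≈ ¬ x ∧ ⊥
    ¬x∧x≈¬x∧⊥ = trans (∧-complementˡ x) (sym (∧-zeroʳ (¬ x)))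

  equivalent-sound : ∀ n (e f : Expr n) → T (equivalent n e f) → ∀ ρ → ⟦ e ⟧ ρ ≈ ⟦ f ⟧ ρ
  equivalent-sound zero e f eq [] = begin
    ⟦ e ⟧ []       ≈⟨ ⟦⟧-closed e ⟩
    ⌜ evalᴮ e ⌝    ≡⟨ ≡.cong ⌜_⌝ (toWitness {a? = evalᴮ e Bool.≟ evalᴮ f} eq) ⟩
    ⌜ evalᴮ f ⌝    ≈⟨ ⟦⟧-closed f ⟨
    ⟦ f ⟧ []       ∎
  equivalent-sound (suc n) e f eq (x ∷ ρ) = begin
    ⟦ e ⟧ (x ∷ ρ)                                       ≈⟨ shannon e x ρ ⟩
    (x ∧ ⟦ e [ true ] ⟧ ρ) ∨ (¬ x ∧ ⟦ e [ false ] ⟧ ρ)  ≈⟨ ∨-cong (∧-congˡ at-true) (∧-congˡ at-false) ⟩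
    (x ∧ ⟦ f [ true ] ⟧ ρ) ∨ (¬ x ∧ ⟦ f [ false ] ⟧ ρ)  ≈⟨ shannon f x ρ ⟨
    ⟦ f ⟧ (x ∷ ρ)                                       ∎
    where
    both = Equivalence.to T-∧ eq
    at-true  = equivalent-sound n (e [ true ]) (f [ true ]) (proj₁ both) ρ
    at-false = equivalent-sound n (e [ false ]) (f [ false ]) (proj₂ both) ρ

  prove : ∀ n (f : N-ary n (Expr n) (Expr n × Expr n)) →
          {_ : T (equivalent n (proj₁ (close n f)) (proj₂ (close n f)))} →
          ∀ ρ → ⟦ proj₁ (close n f) ⟧ ρ ≈ ⟦ proj₂ (close n f) ⟧ ρ
  prove n f {eq} = equivalent-sound n (proj₁ (close n f)) (proj₂ (close n f)) eq

_⋈ᵉ_ : ∀ {n} → Expr n × Expr n → Expr n × Expr n → Expr n × Expr n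
(p , q) ⋈ᵉ (r , s) = (p and not s) or r , (q and not r) or s

_⊕ᵉ_ : ∀ {n} → Expr n → Expr n × Expr n → Expr n
a ⊕ᵉ (p , q) = (a or p) and not q

module _ {c ℓ : Level} (L : BooleanAlgebra c ℓ) where
  open BooleanAlgebra L
  open BowtieChange L
  open Tautology L
  open import Algebra.Lattice.Properties.BooleanAlgebra L using (∧-zeroˡ; ∨-identityʳ)
  open import Relation.Binary.Reasoning.Setoid setoid

  ⋈-closed : ∀ x y → InBowtie x → InBowtie y → InBowtie (x ⋈ y)
  ⋈-closed (p , q) (r , s) p∧q≈⊥ r∧s≈⊥ = begin
    ((p ∧ ¬ s) ∨ r) ∧ ((q ∧ ¬ r) ∨ s)
      ≈⟨ prove 4 (λ p q r s → ((p and not s) or r) and ((q and not r) or s)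
                              ⊜ ((p and q) and not (r or s)) or (r and s))
               (p ∷ q ∷ r ∷ s ∷ []) ⟩
    ((p ∧ q) ∧ ¬ (r ∨ s)) ∨ (r ∧ s)  ≈⟨ ∨-cong (∧-congʳ p∧q≈⊥) r∧s≈⊥ ⟩
    (⊥ ∧ ¬ (r ∨ s)) ∨ ⊥              ≈⟨ ∨-identityʳ _ ⟩
    ⊥ ∧ ¬ (r ∨ s)                    ≈⟨ ∧-zeroˡ _ ⟩
    ⊥                                ∎

  ⋈-identityˡ : ∀ x → InBowtie x → (𝟘 ⋈ x) ≈ₚ x
  ⋈-identityˡ (r , s) _ =
      prove 2 (λ r s → proj₁ ((bot , bot) ⋈ᵉ (r , s)) ⊜ r) (r ∷ s ∷ [])
    , prove 2 (λ r s → proj₂ ((bot , bot) ⋈ᵉ (r , s)) ⊜ s) (r ∷ s ∷ [])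

  ⋈-identityʳ : ∀ x → InBowtie x → (x ⋈ 𝟘) ≈ₚ x
  ⋈-identityʳ (p , q) _ =
      prove 2 (λ p q → proj₁ ((p , q) ⋈ᵉ (bot , bot)) ⊜ p) (p ∷ q ∷ [])
    , prove 2 (λ p q → proj₂ ((p , q) ⋈ᵉ (bot , bot)) ⊜ q) (p ∷ q ∷ [])

  ⋈-assoc : ∀ x y z → InBowtie x → InBowtie y → InBowtie z → ((x ⋈ y) ⋈ z) ≈ₚ (x ⋈ (y ⋈ z))
  ⋈-assoc (p , q) (r , s) (t , u) _ _ _ =
      prove 6 (λ p q r s t u → proj₁ (((p , q) ⋈ᵉ (r , s)) ⋈ᵉ (t , u))
                               ⊜ proj₁ ((p , q) ⋈ᵉ ((r , s) ⋈ᵉ (t , u)))) ρ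
    , prove 6 (λ p q r s t u → proj₂ (((p , q) ⋈ᵉ (r , s)) ⋈ᵉ (t , u))
                               ⊜ proj₂ ((p , q) ⋈ᵉ ((r , s) ⋈ᵉ (t , u)))) ρ
    where ρ = p ∷ q ∷ r ∷ s ∷ t ∷ u ∷ []

  ⊕-identity : ∀ a → (a ⊕ 𝟘) ≈ a
  ⊕-identity a = prove 1 (λ a → a ⊕ᵉ (bot , bot) ⊜ a) (a ∷ [])

  ⊕-⋈ : ∀ a x y → InBowtie x → InBowtie y → (a ⊕ (x ⋈ y)) ≈ ((a ⊕ x) ⊕ y)
  ⊕-⋈ a (p , q) (r , s) _ _ =
    prove 5 (λ a p q r s → a ⊕ᵉ ((p , q) ⋈ᵉ (r , s)) ⊜ (a ⊕ᵉ (p , q)) ⊕ᵉ (r , s))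
            (a ∷ p ∷ q ∷ r ∷ s ∷ [])

  ⊕-transitive : ∀ a b → Σ Pair (λ x → InBowtie x × (a ⊕ x) ≈ b)
  ⊕-transitive a b =
      (b ∧ ¬ a , a ∧ ¬ b)
    , prove 2 (λ a b → (b and not a) and (a and not b) ⊜ bot) (a ∷ b ∷ [])
    , prove 2 (λ a b → a ⊕ᵉ (b and not a , a and not b) ⊜ b) (a ∷ b ∷ [])

  bowtieIsCompleteChangeAction : BowtieIsCompleteChangeAction
  bowtieIsCompleteChangeAction = record
    { closed     = ⋈-closed
    ; zero-in    = ∧-zeroˡ ⊥
    ; identityˡ  = ⋈-identityˡ
    ; identityʳ  = ⋈-identityʳ
    ; assoc      = ⋈-assoc
    ; act-zero   = ⊕-identity
    ; act-comp   = ⊕-⋈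
    ; transitive = ⊕-transitive
    }

mainTheorem1 : ∀ {c ℓ : Level} (L : BooleanAlgebra c ℓ) →
    BowtieChange.BowtieIsCompleteChangeAction L
mainTheorem1 = bowtieIsCompleteChangeAction
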